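{- For all integers $n \geq r \geq 2$ and $d \geq 1$, $$e(n,r,d) \leq \binom{r}{2} + (n-r)\frac{r-1}{\gamma(d-1)}.$$
   Context: A simple undirected graph is $(2,3)$-agreeable if any three vertices induce a subgraph with at least one edge. The boxicity $\mathrm{box}(G)$ is the smallest $d\ge0$ such that $G$ is the intersection graph of a family of $d$-boxes (products of $d$ closed intervals), with the convention $\mathrm{box}(K_n)=0$. $\mathcal{G}_d(r)$ is the set of $(2,3)$-agreeable graphs with boxicity at most $d$ and clique number at most $r$; $e(n,r,d)$ is the maximal number of edges of a graph in $\mathcal{G}_d(r)$ with $n$ vertices. For $d\ge 0$, $\gamma(d)$ is the minimal agreement proportion of $(2,3)$-agreeable graphs of boxicity at most $d$, i.e. the infimum of $\omega(G)/\#V(G)$ over all such graphs $G$ (where $\omega$ is the clique number); equivalently for $d\ge1$ the infimum over $(2,3)$-agreeable arrangements of $n$ $d$-boxes of (maximal number of boxes sharing a point)$/n$.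
   Formalization: The d-boxes that define boxicity, for the graph and also for the graphs in the infimum defining γ(d−1), have rational endpoints. -}

module Defs where

open import Data.Nat using (ℕ; zero; suc; _+_; _*_; _∸_; _≤_; _<_; _<ᵇ_)
open import Data.Bool using (Bool; true; false; _∧_; if_then_else_)
open import Data.Fin using (Fin; toℕ)
open import Data.List using (List; map; concatMap; allFin)
open import Data.Nat.ListAction using (sum)
open import Data.Product using (Σ; _×_; _,_; proj₁; proj₂)
open import Data.Sum using (_⊎_)
open import Relation.Binary.PropositionalEquality using (_≡_; _≢_)
open import Function.Definitions using (Injective)
open import Data.Rational using (ℚ) renaming (_≤_ to _≤ℚ_)

record Graph (n : ℕ) : Set where
  field
    adj   : Fin n → Fin n → Bool
    sym   : ∀ i j → adj i j ≡ adj j i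
    irrefl : ∀ i → adj i i ≡ false
open Graph public

edges : ∀ {n} → Graph n → ℕ
edges {n} G =
  sum (concatMap (λ i → map (λ j → if (toℕ i <ᵇ toℕ j) ∧ adj G i j then 1 else 0)
                            (allFin n))
                 (allFin n))

Agreeable : ∀ {n} → Graph n → Set
Agreeable {n} G = ∀ (i j k : Fin n) → i ≢ j → j ≢ k → i ≢ k →
  (adj G i j ≡ true) ⊎ ((adj G j k ≡ true) ⊎ (adj G i k ≡ true))

HasClique : ∀ {n} → Graph n → ℕ → Set
HasClique {n} G k = Σ (Fin k → Fin n) λ f →
  Injective _≡_ _≡_ f × (∀ a b → a ≢ b → adj G (f a) (f b) ≡ true)

CliqueNumberAtMost : ∀ {n} → ℕ → Graph n → Set
CliqueNumberAtMost r G = ∀ k → HasClique G k → k ≤ r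

IsCliqueNumber : ∀ {n} → Graph n → ℕ → Set
IsCliqueNumber G w = HasClique G w × (∀ k → HasClique G k → k ≤ w)

-- A d-box: for each coordinate a closed interval [lo, hi] with lo ≤ hi.
-- Endpoints are rational.
Box : ℕ → Set
Box d = Fin d → ℚ × ℚ

WellFormedBox : ∀ {d} → Box d → Set
WellFormedBox b = ∀ c → proj₁ (b c) ≤ℚ proj₂ (b c)

BoxesIntersect : ∀ {d} → Box d → Box d → Set
BoxesIntersect b b' = ∀ c → (proj₁ (b c) ≤ℚ proj₂ (b' c)) × (proj₁ (b' c) ≤ℚ proj₂ (b c))

-- box(G) ≤ d : G is the intersection graph of a family of d-boxes.
-- For d = 0 this says G is complete, matching the convention box(K_n) = 0.
BoxicityAtMost : ∀ {n} → ℕ → Graph n → Set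
BoxicityAtMost {n} d G = Σ (Fin n → Box d) λ B →
  (∀ i → WellFormedBox (B i)) ×
  (∀ i j → i ≢ j → (adj G i j ≡ true → BoxesIntersect (B i) (B j))
                 × (BoxesIntersect (B i) (B j) → adj G i j ≡ true))

-- The positive rational p/s is a lower bound for the agreement proportions
-- ω(H)/|V(H)| of all nonempty (2,3)-agreeable graphs H with box(H) ≤ d,
-- i.e. p/s ≤ γ(d).
IsLowerBoundγ : ℕ → ℕ → ℕ → Set
IsLowerBoundγ d p s = ∀ (m : ℕ) → 1 ≤ m → (H : Graph m) → Agreeable H →
  BoxicityAtMost d H → ∀ w → IsCliqueNumber H w → p * m ≤ s * w

-- Order the boxes by the right endpoint of their first interval and peel off a
-- vertex v whose right endpoint is minimal.  Every remaining neighbour u of v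
-- has its first interval straddling that endpoint, so the first intervals of
-- the neighbours share a point and the neighbourhood is represented by the
-- remaining d - 1 coordinates.  It is (2,3)-agreeable and, being joined to v,
-- has clique number at most r - 1; by the definition of γ(d - 1) it has at
-- most (r - 1)/γ(d - 1) vertices.  Each of the n - r peeled vertices thus
-- contributes at most that many edges, and the last r vertices at most C(r,2).

module Submission where

open import Defs hiding (sym)
open import Data.Bool using (true; false; _∧_; if_then_else_)
import Data.Bool.Properties as Bool
open import Data.Fin using (Fin; zero; suc; toℕ; _≟_)
import Data.Fin.Properties as Fin
open import Data.List using (List; []; _∷_; map; concatMap; allFin; length; lookup; filter)
open import Data.List.Properties using (length-tabulate)
open import Data.List.Membership.Propositional.Properties using (∈-lookup)
open import Data.List.Relation.Unary.All as All using (All; []; _∷_)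
open import Data.List.Relation.Unary.All.Properties using (all-filter)
  renaming (filter⁺ to All-filter⁺)
open import Data.List.Relation.Unary.AllPairs using (_∷_)
open import Data.List.Relation.Unary.Unique.Propositional using (Unique)
open import Data.List.Relation.Unary.Unique.Propositional.Properties using (allFin⁺)
  renaming (filter⁺ to Unique-filter⁺)
import Data.List.Relation.Binary.Permutation.Propositional as ↭
open ↭ using (_↭_; ↭-sym; ↭⇒↭ₛ)
open import Data.List.Relation.Binary.Permutation.Propositional.Properties
  using (All-resp-↭; map⁺; ↭-length)
import Data.List.Relation.Binary.Permutation.Setoid.Properties as Permutationₛ
open import Data.Nat using (ℕ; zero; suc; _+_; _*_; _∸_; _≤_; _<_; _<ᵇ_; z≤n; s≤s)
open import Data.Nat.Combinatorics using (_C_; nC1≡n; nCk+nC[k+1]≡[n+1]C[k+1])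
open import Data.Nat.ListAction using (sum)
open import Data.Nat.ListAction.Properties using (sum-++; sum-↭)
open import Data.Nat.Properties
  using ( +-commutativeSemigroup; +-assoc; +-identityʳ; +-suc; +-mono-≤; suc-injective
        ; *-comm; *-assoc; *-zeroʳ; *-distribˡ-+; *-monoʳ-≤; ∸-monoˡ-≤; m+[n∸m]≡n
        ; ≤-refl; ≤-reflexive; ≤-trans; ≤-pred; ≤∧≢⇒<; m≤n⇒m≤1+n; module ≤-Reasoning )
open import Algebra.Properties.CommutativeSemigroup +-commutativeSemigroup
  using (interchange; x∙yz≈y∙xz)
open import Data.Product using (∃; ∃₂; _×_; _,_; proj₁; proj₂)
open import Data.Sum using (_⊎_; inj₁; inj₂)
open import Data.Rational using (ℚ) renaming (_≤_ to _≤ℚ_)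
import Data.Rational.Properties as ℚ
import Data.Vec.Functional as Vector
open import Function using (_∘_)
open import Relation.Nullary using (Dec; yes; no; ¬?; contradiction)
open import Relation.Nullary.Decidable using (_→-dec_; map′)
open import Relation.Binary.PropositionalEquality
  using (_≡_; _≢_; _≗_; refl; sym; trans; cong; cong₂; subst₂; ≢-sym; setoid; module ≡-Reasoning)

Unique⇒lookup-≢ : ∀ {a} {A : Set a} {xs : List A} → Unique xs →
  ∀ {i j} → i ≢ j → lookup xs i ≢ lookup xs j
Unique⇒lookup-≢ (_ ∷ _)  {zero}  {zero}  i≢j = contradiction refl i≢j
Unique⇒lookup-≢ (x∉ ∷ _) {zero}  {suc j} _   = All.lookup x∉ (∈-lookup j)
Unique⇒lookup-≢ (x∉ ∷ _) {suc i} {zero}  _   = ≢-sym (All.lookup x∉ (∈-lookup i))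
Unique⇒lookup-≢ (_ ∷ u)  {suc i} {suc j} i≢j = Unique⇒lookup-≢ u (i≢j ∘ cong suc)

Unique-resp-↭ : ∀ {a} {A : Set a} {xs ys : List A} → xs ↭ ys → Unique xs → Unique ys
Unique-resp-↭ {A = A} π = Permutationₛ.Unique-resp-↭ (setoid A) (↭⇒↭ₛ π)

extractMin : ∀ {a} {A : Set a} (key : A → ℚ) (x : A) (xs : List A) →
  ∃₂ λ v ys → (x ∷ xs ↭ v ∷ ys) × All (λ u → key v ≤ℚ key u) ys
extractMin key x [] = x , [] , ↭.refl , []
extractMin key x (y ∷ ys) with extractMin key y ys
... | v , zs , π , v-min with ℚ.≤-total (key x) (key v)
...   | inj₁ x≤v = x , y ∷ ys , ↭.refl ,
                   All-resp-↭ (↭-sym π) (x≤v ∷ All.map (ℚ.≤-trans x≤v) v-min)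
...   | inj₂ v≤x = v , x ∷ zs , ↭.trans (↭.prep x π) (↭.swap x v ↭.refl) , v≤x ∷ v-min

sum-concatMap : ∀ {a} {A : Set a} (f : A → List ℕ) (xs : List A) →
  sum (concatMap f xs) ≡ sum (map (sum ∘ f) xs)
sum-concatMap f []       = refl
sum-concatMap f (x ∷ xs) = trans (sum-++ (f x) (concatMap f xs)) (cong (sum (f x) +_) (sum-concatMap f xs))

sum-map-+ : ∀ {a} {A : Set a} (f g : A → ℕ) (xs : List A) →
  sum (map (λ x → f x + g x) xs) ≡ sum (map f xs) + sum (map g xs)
sum-map-+ f g []       = refl
sum-map-+ f g (x ∷ xs) = trans (cong (f x + g x +_) (sum-map-+ f g xs)) (interchange (f x) (g x) _ _)

module PairSums {a} {A : Set a} (g : A → A → ℕ) where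

  rowSum : A → List A → ℕ
  rowSum x ys = sum (map (g x) ys)

  pairSum : List A → ℕ
  pairSum []       = 0
  pairSum (x ∷ xs) = rowSum x xs + pairSum xs

  rowSum-↭ : ∀ x {xs ys} → xs ↭ ys → rowSum x xs ≡ rowSum x ys
  rowSum-↭ x π = sum-↭ (map⁺ (g x) π)

  pairSum-↭ : (∀ x y → g x y ≡ g y x) → ∀ {xs ys} → xs ↭ ys → pairSum xs ≡ pairSum ys
  pairSum-↭ g-sym ↭.refl          = refl
  pairSum-↭ g-sym (↭.prep x π)    = cong₂ _+_ (rowSum-↭ x π) (pairSum-↭ g-sym π)
  pairSum-↭ g-sym (↭.trans π ρ)   = trans (pairSum-↭ g-sym π) (pairSum-↭ g-sym ρ)
  pairSum-↭ g-sym {x ∷ y ∷ xs} {_ ∷ _ ∷ ys} (↭.swap x y π) = begin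
    (g x y + rowSum x xs) + (rowSum y xs + pairSum xs)
      ≡⟨ cong₂ (λ u w → (g x y + u) + w) (rowSum-↭ x π)
               (cong₂ _+_ (rowSum-↭ y π) (pairSum-↭ g-sym π)) ⟩
    (g x y + rowSum x ys) + (rowSum y ys + pairSum ys)
      ≡⟨ interchange (g x y) (rowSum x ys) (rowSum y ys) (pairSum ys) ⟩
    (g x y + rowSum y ys) + (rowSum x ys + pairSum ys)
      ≡⟨ cong (λ u → (u + rowSum y ys) + (rowSum x ys + pairSum ys)) (g-sym x y) ⟩
    (g y x + rowSum y ys) + (rowSum x ys + pairSum ys) ∎
    where open ≡-Reasoning

  pairSum≤C2 : (∀ x y → g x y ≤ 1) → ∀ xs → pairSum xs ≤ length xs C 2
  pairSum≤C2 g≤1 []       = z≤n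
  pairSum≤C2 g≤1 (x ∷ xs) = begin
    rowSum x xs + pairSum xs       ≤⟨ +-mono-≤ (rowSum≤length xs) (pairSum≤C2 g≤1 xs) ⟩
    length xs + length xs C 2      ≡⟨ cong (_+ length xs C 2) (nC1≡n (length xs)) ⟨
    length xs C 1 + length xs C 2  ≡⟨ nCk+nC[k+1]≡[n+1]C[k+1] (length xs) 1 ⟩
    suc (length xs) C 2            ∎
    where
    open ≤-Reasoning
    rowSum≤length : ∀ ys → rowSum x ys ≤ length ys
    rowSum≤length []       = z≤n
    rowSum≤length (y ∷ ys) = +-mono-≤ (g≤1 x y) (rowSum≤length ys)

  squareSum≡pairSum : (f : A → A → ℕ) → (∀ x → f x x ≡ 0) →
    (∀ x y → x ≢ y → f x y + f y x ≡ g x y) →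
    ∀ {xs} → Unique xs → sum (map (λ x → sum (map (f x) xs)) xs) ≡ pairSum xs
  squareSum≡pairSum f f-diag f-split = square≡pairSum
    where
    square : List A → List A → ℕ
    square xs ys = sum (map (λ x → sum (map (f x) ys)) xs)

    split : ∀ x ys → All (x ≢_) ys → sum (map (f x) ys) + sum (map (λ y → f y x) ys) ≡ rowSum x ys
    split x []       []             = refl
    split x (y ∷ ys) (x≢y ∷ x∉ys) =
      trans (interchange (f x y) _ (f y x) _) (cong₂ _+_ (f-split x y x≢y) (split x ys x∉ys))

    square≡pairSum : ∀ {xs} → Unique xs → square xs xs ≡ pairSum xs
    square≡pairSum {[]}     _             = refl
    square≡pairSum {x ∷ xs} (x∉xs ∷ u) = begin
      (f x x + sum (map (f x) xs)) + square xs (x ∷ xs)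
        ≡⟨ cong₂ _+_ (cong (_+ sum (map (f x) xs)) (f-diag x))
                     (sum-map-+ (λ y → f y x) (λ y → sum (map (f y) xs)) xs) ⟩
      sum (map (f x) xs) + (sum (map (λ y → f y x) xs) + square xs xs)
        ≡⟨ +-assoc (sum (map (f x) xs)) _ _ ⟨
      (sum (map (f x) xs) + sum (map (λ y → f y x) xs)) + square xs xs
        ≡⟨ cong₂ _+_ (split x xs x∉xs) (square≡pairSum u) ⟩
      rowSum x xs + pairSum xs ∎
      where open ≡-Reasoning

  pairSum-peeling : (∀ x y → g x y ≡ g y x) → (∀ x y → g x y ≤ 1) → (p c k : ℕ) →
    (∀ {x xs} → Unique (x ∷ xs) → ∃₂ λ v ys → (x ∷ xs ↭ v ∷ ys) × p * rowSum v ys ≤ c) →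
    ∀ m {xs} → Unique xs → length xs ≡ k + m → p * pairSum xs ≤ p * (k C 2) + m * c
  pairSum-peeling g-sym g≤1 p c k peel zero {xs} _ |xs| = begin
    p * pairSum xs       ≤⟨ *-monoʳ-≤ p (pairSum≤C2 g≤1 xs) ⟩
    p * (length xs C 2)  ≡⟨ cong (λ l → p * (l C 2)) (trans |xs| (+-identityʳ k)) ⟩
    p * (k C 2)          ≡⟨ +-identityʳ _ ⟨
    p * (k C 2) + 0      ∎
    where open ≤-Reasoning
  pairSum-peeling g-sym g≤1 p c k peel (suc m) {[]} _ |xs| =
    contradiction (trans |xs| (+-suc k m)) λ ()
  pairSum-peeling g-sym g≤1 p c k peel (suc m) {x ∷ xs} u |xs|
    with peel u
  ... | v , ys , π , v-bound with Unique-resp-↭ π u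
  ...   | _ ∷ u-ys = begin
    p * pairSum (x ∷ xs)                    ≡⟨ cong (p *_) (pairSum-↭ g-sym π) ⟩
    p * (rowSum v ys + pairSum ys)          ≡⟨ *-distribˡ-+ p (rowSum v ys) (pairSum ys) ⟩
    p * rowSum v ys + p * pairSum ys        ≤⟨ +-mono-≤ v-bound
                                                 (pairSum-peeling g-sym g≤1 p c k peel m u-ys |ys|) ⟩
    c + (p * (k C 2) + m * c)               ≡⟨ x∙yz≈y∙xz c (p * (k C 2)) (m * c) ⟩
    p * (k C 2) + suc m * c                 ∎
    where
    open ≤-Reasoning
    |ys| : length ys ≡ k + m
    |ys| = suc-injective (trans (sym (↭-length π)) (trans |xs| (+-suc k m)))

<ᵇ-trichotomy : ∀ {m n} → m ≢ n →
  ((m <ᵇ n) ≡ true × (n <ᵇ m) ≡ false) ⊎ ((m <ᵇ n) ≡ false × (n <ᵇ m) ≡ true)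
<ᵇ-trichotomy {zero}  {zero}  m≢n = contradiction refl m≢n
<ᵇ-trichotomy {zero}  {suc n} _   = inj₁ (refl , refl)
<ᵇ-trichotomy {suc m} {zero}  _   = inj₂ (refl , refl)
<ᵇ-trichotomy {suc m} {suc n} m≢n = <ᵇ-trichotomy (m≢n ∘ cong suc)

<ᵇ-irrefl : ∀ m → (m <ᵇ m) ≡ false
<ᵇ-irrefl zero    = refl
<ᵇ-irrefl (suc m) = <ᵇ-irrefl m

module EdgeCounting {n} (G : Graph n) where

  adjacency : Fin n → Fin n → ℕ
  adjacency x y = if adj G x y then 1 else 0

  open PairSums adjacency public

  adjacency-sym : ∀ x y → adjacency x y ≡ adjacency y x
  adjacency-sym x y = cong (λ b → if b then 1 else 0) (Graph.sym G x y)

  adjacency≤1 : ∀ x y → adjacency x y ≤ 1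
  adjacency≤1 x y with adj G x y
  ... | true  = ≤-refl
  ... | false = z≤n

  edges≡pairSum : edges G ≡ pairSum (allFin n)
  edges≡pairSum = trans (sum-concatMap (λ i → map (upper i) (allFin n)) (allFin n))
                        (squareSum≡pairSum upper upper-diag upper-split (allFin⁺ n))
    where
    upper : Fin n → Fin n → ℕ
    upper i j = if (toℕ i <ᵇ toℕ j) ∧ adj G i j then 1 else 0

    upper-diag : ∀ i → upper i i ≡ 0
    upper-diag i rewrite <ᵇ-irrefl (toℕ i) = refl

    upper-split : ∀ i j → i ≢ j → upper i j + upper j i ≡ adjacency i j
    upper-split i j i≢j with <ᵇ-trichotomy (i≢j ∘ Fin.toℕ-injective)
    ... | inj₁ (i<j , j≮i) rewrite i<j | j≮i = +-identityʳ (adjacency i j)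
    ... | inj₂ (i≮j , j<i) rewrite i≮j | j<i = adjacency-sym j i

  neighbours : Fin n → List (Fin n) → List (Fin n)
  neighbours v = filter (λ u → adj G v u Bool.≟ true)

  length-neighbours : ∀ v us → length (neighbours v us) ≡ rowSum v us
  length-neighbours v []       = refl
  length-neighbours v (u ∷ us) with adj G v u
  ... | true  = cong suc (length-neighbours v us)
  ... | false = length-neighbours v us

anyFunction? : ∀ {p m} k {P : (Fin k → Fin m) → Set p} →
  (∀ {f g} → f ≗ g → P f → P g) → (∀ f → Dec (P f)) → Dec (∃ P)
anyFunction? zero    P-resp P? = map′ (Vector.[] ,_) (λ (f , Pf) → P-resp (λ ()) Pf) (P? Vector.[])
anyFunction? (suc k) P-resp P? =
  map′ (λ (x , f , Pf) → x Vector.∷ f , Pf)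
       (λ (f , Pf) → f zero , f ∘ suc , P-resp (λ { zero → refl ; (suc i) → refl }) Pf)
       (Fin.any? λ x → anyFunction? k (λ f≗g → P-resp (λ { zero → refl ; (suc i) → f≗g i }))
                                      (λ f → P? (x Vector.∷ f)))

module _ {m} (H : Graph m) where

  adj⇒≢ : ∀ {x y} → adj H x y ≡ true → x ≢ y
  adj⇒≢ {x} x~x refl with trans (sym x~x) (irrefl H x)
  ... | ()

  PairwiseAdjacent : ∀ {k} → (Fin k → Fin m) → Set
  PairwiseAdjacent f = ∀ a b → a ≢ b → adj H (f a) (f b) ≡ true

  pairwiseAdjacent⇒HasClique : ∀ {k} (f : Fin k → Fin m) → PairwiseAdjacent f → HasClique H k
  pairwiseAdjacent⇒HasClique f f-adj = f , injective , f-adj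
    where
    injective : ∀ {a b} → f a ≡ f b → a ≡ b
    injective {a} {b} fa≡fb with a ≟ b
    ... | yes a≡b = a≡b
    ... | no  a≢b = contradiction fa≡fb (adj⇒≢ (f-adj a b a≢b))

  HasClique? : ∀ k → Dec (HasClique H k)
  HasClique? k = map′ (λ (f , f-adj) → pairwiseAdjacent⇒HasClique f f-adj)
                      (λ (f , _ , f-adj) → f , f-adj)
                      (anyFunction? k resp adjacent?)
    where
    resp : ∀ {f g : Fin k → Fin m} → f ≗ g → PairwiseAdjacent f → PairwiseAdjacent g
    resp f≗g f-adj a b a≢b = subst₂ (λ x y → adj H x y ≡ true) (f≗g a) (f≗g b) (f-adj a b a≢b)

    adjacent? : ∀ f → Dec (PairwiseAdjacent f)
    adjacent? f = Fin.all? λ a → Fin.all? λ b → ¬? (a ≟ b) →-dec (adj H (f a) (f b) Bool.≟ true)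

  cliqueNumber : ∀ t → CliqueNumberAtMost t H → ∃ λ w → IsCliqueNumber H w × w ≤ t
  cliqueNumber zero    ω≤0 = 0 , (pairwiseAdjacent⇒HasClique (λ ()) (λ ()) , ω≤0) , z≤n
  cliqueNumber (suc t) ω≤t+1 with HasClique? (suc t)
  ... | yes clique = suc t , (clique , ω≤t+1) , ≤-refl
  ... | no ¬clique = let w , isω , w≤t = cliqueNumber t ω≤t in w , isω , m≤n⇒m≤1+n w≤t
    where
    ω≤t : CliqueNumberAtMost t H
    ω≤t k clique = ≤-pred (≤∧≢⇒< (ω≤t+1 k clique) λ { refl → ¬clique clique })

module _ {n} (G : Graph n) where

  induced : (N : List (Fin n)) → Graph (length N)
  induced N = record
    { adj    = λ a b → adj G (lookup N a) (lookup N b)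
    ; sym    = λ a b → Graph.sym G (lookup N a) (lookup N b)
    ; irrefl = λ a → irrefl G (lookup N a)
    }

  induced-agreeable : Agreeable G → ∀ {N} → Unique N → Agreeable (induced N)
  induced-agreeable agreeable u a b c a≢b b≢c a≢c =
    agreeable _ _ _ (Unique⇒lookup-≢ u a≢b) (Unique⇒lookup-≢ u b≢c) (Unique⇒lookup-≢ u a≢c)

  induced-common-neighbour : ∀ {r v N} → CliqueNumberAtMost r G →
    All (λ u → adj G v u ≡ true) N → CliqueNumberAtMost (r ∸ 1) (induced N)
  induced-common-neighbour {r} {v} {N} ω≤r v~N k (f , _ , f-adj) =
    ∸-monoˡ-≤ 1 (ω≤r (suc k) (pairwiseAdjacent⇒HasClique G cone cone-adj))
    where
    cone : Fin (suc k) → Fin n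
    cone = v Vector.∷ (lookup N ∘ f)

    v~ : ∀ a → adj G v (lookup N (f a)) ≡ true
    v~ a = All.lookup v~N (∈-lookup (f a))

    cone-adj : PairwiseAdjacent G cone
    cone-adj zero    zero    0≢0 = contradiction refl 0≢0
    cone-adj zero    (suc b) _   = v~ b
    cone-adj (suc a) zero    _   = trans (Graph.sym G _ v) (v~ a)
    cone-adj (suc a) (suc b) a≢b = f-adj a b (a≢b ∘ cong suc)

Represents : ∀ {n d} → Graph n → (Fin n → Box d) → Set
Represents G B = ∀ i j → i ≢ j → (adj G i j ≡ true → BoxesIntersect (B i) (B j))
                               × (BoxesIntersect (B i) (B j) → adj G i j ≡ true)

-- Intervals through a common point always meet, so the first coordinate can be dropped.
induced-boxicity : ∀ {n d} (G : Graph n) {B : Fin n → Box (suc d)} →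
  (∀ i → WellFormedBox (B i)) → Represents G B → ∀ {N} → Unique N → (t : ℚ) →
  All (λ u → proj₁ (B u zero) ≤ℚ t × t ≤ℚ proj₂ (B u zero)) N → BoxicityAtMost d (induced G N)
induced-boxicity G {B} wf represents {N} u t N∋t =
  (λ a c → B (lookup N a) (suc c)) , (λ a c → wf (lookup N a) (suc c)) , represents′
  where
  ∋t : ∀ a → proj₁ (B (lookup N a) zero) ≤ℚ t × t ≤ℚ proj₂ (B (lookup N a) zero)
  ∋t a = All.lookup N∋t (∈-lookup a)

  represents′ : Represents (induced G N) (λ a c → B (lookup N a) (suc c))
  represents′ a b a≢b =
    (λ a~b c → proj₁ (represents _ _ (Unique⇒lookup-≢ u a≢b)) a~b (suc c)) ,
    (λ meet → proj₂ (represents _ _ (Unique⇒lookup-≢ u a≢b)) λ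
      { zero    → ℚ.≤-trans (proj₁ (∋t a)) (proj₂ (∋t b)) , ℚ.≤-trans (proj₁ (∋t b)) (proj₂ (∋t a))
      ; (suc c) → meet c })

IsLowerBoundγ⇒vertexBound : ∀ {d k m} p s → IsLowerBoundγ d p s → (H : Graph m) →
  Agreeable H → BoxicityAtMost d H → CliqueNumberAtMost k H → p * m ≤ s * k
IsLowerBoundγ⇒vertexBound {m = zero} p s _ _ _ _ _ = ≤-trans (≤-reflexive (*-zeroʳ p)) z≤n
IsLowerBoundγ⇒vertexBound {k = k} {suc m} p s γ≥p/s H agreeable boxicity ω≤k
  with cliqueNumber H k ω≤k
... | w , isω , w≤k = ≤-trans (γ≥p/s (suc m) (s≤s z≤n) H agreeable boxicity w isω) (*-monoʳ-≤ s w≤k)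

module Peeling {n d r} (G : Graph n) (agreeable : Agreeable G) {B : Fin n → Box (suc d)}
  (wf : ∀ i → WellFormedBox (B i)) (represents : Represents G B)
  (ω≤r : CliqueNumberAtMost r G) (p s : ℕ) (γ≥p/s : IsLowerBoundγ d p s) where

  open EdgeCounting G

  lo hi : Fin n → ℚ
  lo u = proj₁ (B u zero)
  hi u = proj₂ (B u zero)

  minimal-degree-bound : ∀ {v us} → Unique (v ∷ us) → All (λ u → hi v ≤ℚ hi u) us →
    p * rowSum v us ≤ (r ∸ 1) * s
  minimal-degree-bound {v} {us} (_ ∷ u-us) v-min = begin
    p * rowSum v us   ≡⟨ cong (p *_) (length-neighbours v us) ⟨
    p * length N      ≤⟨ IsLowerBoundγ⇒vertexBound p s γ≥p/s (induced G N)
                           (induced-agreeable G agreeable u-N)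
                           (induced-boxicity G wf represents u-N (hi v) (All.map straddles N-facts))
                           (induced-common-neighbour G ω≤r (All.map proj₁ N-facts)) ⟩
    s * (r ∸ 1)       ≡⟨ *-comm s (r ∸ 1) ⟩
    (r ∸ 1) * s       ∎
    where
    open ≤-Reasoning
    N = neighbours v us

    u-N : Unique N
    u-N = Unique-filter⁺ _ u-us

    N-facts : All (λ u → adj G v u ≡ true × hi v ≤ℚ hi u) N
    N-facts = All.zip (all-filter _ us , All-filter⁺ _ v-min)

    straddles : ∀ {u} → adj G v u ≡ true × hi v ≤ℚ hi u → lo u ≤ℚ hi v × hi v ≤ℚ hi u
    straddles (v~u , v≤u) = proj₂ (proj₁ (represents _ _ (adj⇒≢ G v~u)) v~u zero) , v≤u

  peel : ∀ {x xs} → Unique (x ∷ xs) →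
    ∃₂ λ v ys → (x ∷ xs ↭ v ∷ ys) × p * rowSum v ys ≤ (r ∸ 1) * s
  peel {x} {xs} u with extractMin hi x xs
  ... | v , ys , π , v-min = v , ys , π , minimal-degree-bound (Unique-resp-↭ π u) v-min

theoremA4 : (n r d : ℕ) → 2 ≤ r → r ≤ n → 1 ≤ d →
    (G : Graph n) → Agreeable G → BoxicityAtMost d G → CliqueNumberAtMost r G →
    (p s : ℕ) → 0 < p → 0 < s → IsLowerBoundγ (d ∸ 1) p s →
    p * edges G ≤ p * (r C 2) + (n ∸ r) * (r ∸ 1) * s
theoremA4 n r zero _ _ () _ _ _ _ _ _ _ _ _
theoremA4 n r (suc d) _ r≤n _ G agreeable (B , wf , represents) ω≤r p s _ _ γ≥p/s = begin
  p * edges G                            ≡⟨ cong (p *_) edges≡pairSum ⟩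
  p * pairSum (allFin n)                 ≤⟨ pairSum-peeling adjacency-sym adjacency≤1 p ((r ∸ 1) * s) r
                                              (Peeling.peel G agreeable wf represents ω≤r p s γ≥p/s)
                                              (n ∸ r) (allFin⁺ n) |allFin| ⟩
  p * (r C 2) + (n ∸ r) * ((r ∸ 1) * s)  ≡⟨ cong (p * (r C 2) +_) (*-assoc (n ∸ r) (r ∸ 1) s) ⟨
  p * (r C 2) + (n ∸ r) * (r ∸ 1) * s    ∎
  where
  open ≤-Reasoning
  open EdgeCounting G
  |allFin| : length (allFin n) ≡ r + (n ∸ r)
  |allFin| = trans (length-tabulate (λ i → i)) (sym (m+[n∸m]≡n r≤n))
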